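{- Let $G=(V,E)$ be a simple graph and $C\subseteq V$ such that no vertex of $V\setminus C$ is isolated, and let $m$ be a positive integer with $m\ge\gamma_{\rm gr}(G;C)$. Then the optimal value of the integer program $F_1$ equals $\gamma_{\rm gr}(G;C)$.
   Context: $N\langle v\rangle=N[v]$ (closed neighborhood) if $v\in C$ and $N\langle v\rangle=N(v)$ (open neighborhood) otherwise. A sequence $(v_1,\ldots,v_k)$ of distinct vertices is legal if $N\langle v_i\rangle\setminus\bigcup_{j<i}N\langle v_j\rangle\ne\emptyset$ for $i=2,\ldots,k$, dominating if $\bigcup_jN\langle v_j\rangle=V$; $\gamma_{\rm gr}(G;C)$ is the maximum length of a legal dominating sequence. The program $F_1$ has binary variables $x_{vi},y_{vi}$ for $v\in V$, $i=1,\ldots,m$ (and $x_{v0}=1$ as constants) and is: maximize $\sum_{i=1}^m\sum_{v\in V}y_{vi}$ subject to (a) $\sum_{v\in V}y_{vi}\le1$ for $i=1,\ldots,m$; (b) $\sum_{i=1}^m y_{vi}\le1$ for $v\in V$; (c) $x_{ui}\le x_{u(i-1)}$ for $u\in V$, $i=2,\ldots,m$; (d) $x_{ui}+\sum_{v\in N\langle u\rangle}y_{vi}\le1$ for $u\in V$, $i=1,\ldots,m$; (e) $y_{vi}\le\sum_{u\in N\langle v\rangle}(x_{u(i-1)}-x_{ui})$ for $v\in V$, $i=2,\ldots,m$; $x_{vi},y_{vi}\in\{0,1\}$. -}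

module Defs where

open import Data.Nat using (ℕ; zero; suc; _+_; _≤_; _<_; _∸_)
open import Data.Bool using (Bool; true; false; T; if_then_else_; _∨_)
open import Data.Fin using (Fin; toℕ; _≟_)
open import Data.List using (List; length; lookup; map; allFin; upTo)
open import Data.Nat.ListAction using (sum)
open import Data.List.Relation.Unary.Unique.Propositional using (Unique)
open import Data.Product using (Σ; ∃; _×_)
open import Relation.Nullary using (¬_)
open import Relation.Nullary.Decidable using (⌊_⌋)
open import Relation.Binary.PropositionalEquality using (_≡_)

record SimpleGraph (n : ℕ) : Set where
  field
    adj     : Fin n → Fin n → Bool
    symm    : ∀ u v → adj u v ≡ adj v u
    irrefl  : ∀ v → adj v v ≡ false
open SimpleGraph public

-- Subsets C ⊆ V are Bool-valued predicates (C v ≡ true  iff  v ∈ C).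

-- nb G C v u = true  iff  u ∈ N⟨v⟩ ,
-- where N⟨v⟩ = N[v] if v ∈ C and N⟨v⟩ = N(v) otherwise.
nb : ∀ {n} → SimpleGraph n → (Fin n → Bool) → Fin n → Fin n → Bool
nb G C v u = if C v then (⌊ u ≟ v ⌋ ∨ adj G v u) else adj G v u

InN : ∀ {n} → SimpleGraph n → (Fin n → Bool) → Fin n → Fin n → Set
InN G C u v = T (nb G C v u)

-- Legal sequence (v_1,…,v_k) of distinct vertices (0-based positions here):
-- for every position i ≥ 1 (i.e. v_2,…,v_k) some vertex of N⟨v_i⟩ is not in
-- N⟨v_j⟩ for any earlier position j < i.
Legal : ∀ {n} → SimpleGraph n → (Fin n → Bool) → List (Fin n) → Set
Legal G C s =
  Unique s ×
  (∀ (i : Fin (length s)) → 1 ≤ toℕ i →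
     ∃ λ u → InN G C u (lookup s i) ×
       (∀ (j : Fin (length s)) → toℕ j < toℕ i → ¬ InN G C u (lookup s j)))

Dominating : ∀ {n} → SimpleGraph n → (Fin n → Bool) → List (Fin n) → Set
Dominating G C s = ∀ u → ∃ λ (j : Fin (length s)) → InN G C u (lookup s j)

IsGrundyDom : ∀ {n} → SimpleGraph n → (Fin n → Bool) → ℕ → Set
IsGrundyDom G C g =
  (∃ λ s → Legal G C s × Dominating G C s × length s ≡ g) ×
  (∀ s → Legal G C s → Dominating G C s → length s ≤ g)

ΣV : ∀ {n} → (Fin n → ℕ) → ℕ
ΣV {n} f = sum (map f (allFin n))

Σ1to : ℕ → (ℕ → ℕ) → ℕ
Σ1to m f = sum (map (λ i → f (suc i)) (upTo m))

ΣN : ∀ {n} → SimpleGraph n → (Fin n → Bool) → Fin n → (Fin n → ℕ) → ℕ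
ΣN G C u f = ΣV (λ v → if nb G C u v then f v else 0)

-- Variables x y : V → ℕ → ℕ ; only indices 0..m of x and 1..m of y matter;
-- x v 0 = 1 is the fixed constant x_{v0} = 1.
-- Constraint (e) is stated with the subtraction moved to the other side,
-- since the variables are natural numbers.
FeasibleF1 : ∀ {n} → SimpleGraph n → (Fin n → Bool) → ℕ →
             (Fin n → ℕ → ℕ) → (Fin n → ℕ → ℕ) → Set
FeasibleF1 G C m x y =
  (∀ v → x v 0 ≡ 1) ×
  (∀ v i → 1 ≤ i → i ≤ m → x v i ≤ 1 × y v i ≤ 1) ×
  (∀ i → 1 ≤ i → i ≤ m → ΣV (λ v → y v i) ≤ 1) ×
  (∀ v → Σ1to m (λ i → y v i) ≤ 1) ×
  (∀ u i → 2 ≤ i → i ≤ m → x u i ≤ x u (i ∸ 1)) ×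
  (∀ u i → 1 ≤ i → i ≤ m → x u i + ΣN G C u (λ v → y v i) ≤ 1) ×
  -- (e)  y_vi ≤ Σ_{u∈N⟨v⟩} (x_{u(i-1)} − x_{ui})
  (∀ v i → 2 ≤ i → i ≤ m →
     y v i + ΣN G C v (λ u → x u i) ≤ ΣN G C v (λ u → x u (i ∸ 1)))

ObjF1 : ∀ {n} → ℕ → (Fin n → ℕ → ℕ) → ℕ
ObjF1 m y = Σ1to m (λ i → ΣV (λ v → y v i))

IsOptF1 : ∀ {n} → SimpleGraph n → (Fin n → Bool) → ℕ → ℕ → Set
IsOptF1 {n} G C m k =
  (Σ (Fin n → ℕ → ℕ) λ x → Σ (Fin n → ℕ → ℕ) λ y →
     FeasibleF1 G C m x y × ObjF1 m y ≡ k) ×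
  (∀ x y → FeasibleF1 G C m x y → ObjF1 m y ≤ k)

-- A legal dominating sequence s of length g ≤ m is encoded as a feasible
-- point of F₁ by letting y put the i-th vertex of s at step i and letting
-- x u i = 1 exactly when u is not yet footprinted by the first i vertices;
-- so the optimum is at least g. Conversely, the vertices chosen by y in a
-- feasible point, read in the order of their steps, form a legal sequence
-- whose length is the objective: (e) makes every chosen vertex after the
-- first footprint a vertex u with x dropping at that step, and (c), (d)
-- keep x u i = 1 only for vertices not footprinted so far. Since no vertex
-- outside C is isolated, every vertex lies in some N⟨w⟩, so greedily
-- appending such w extends any legal sequence to a legal dominating one,
-- whose length is at most γ_gr(G;C) = g.
module Submission where

open import Defs
open import Data.Nat using (ℕ; _≤_)
open import Data.Bool using (Bool; false; true)
open import Data.Fin using (Fin)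
open import Data.Product using (∃)
open import Relation.Binary.PropositionalEquality using (_≡_)

open import Data.Nat using (zero; suc; _+_; _∸_; _<_; z≤n; s≤s; _≤?_; _<?_)
open import Data.Nat.Properties
  using (≤-refl; ≤-trans; ≤-reflexive; ≤-antisym; <⇒≤; <⇒≱; ≮⇒≥; <-cmp;
         +-identityʳ; +-assoc; +-mono-≤; +-monoˡ-≤; +-mono-<-≤; +-mono-≤-<;
         n≤0⇒n≡0)
open import Data.Bool using (T; if_then_else_; _∨_)
open import Data.Bool.Properties using (∨-assoc; ∨-zeroʳ; ∨-conicalˡ; ∨-conicalʳ; if-eta; if-swap-then; T-≡)
open import Data.Fin using (toℕ) renaming (zero to fzero; suc to fsuc)
open import Data.Fin.Properties using (_≟_; any?)
open import Data.List using (List; []; _∷_; _++_; [_]; _∷ʳ_; length; lookup; map; allFin; take; applyUpTo)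
open import Data.List.Properties using (map-tabulate; length-++; length-++-≤ˡ)
open import Data.Nat.ListAction using (sum)
open import Data.List.Relation.Unary.All as All using (All; []; _∷_)
open import Data.List.Relation.Unary.Any using (here; there)
open import Data.List.Relation.Unary.AllPairs using ([]; _∷_)
open import Data.List.Relation.Unary.Unique.Propositional using (Unique)
open import Data.List.Relation.Unary.Unique.Propositional.Properties using (++⁺)
open import Data.List.Membership.Propositional using (_∈_; _∉_)
open import Data.List.Membership.Propositional.Properties using (∈-allFin; ∈-++⁺ʳ)
open import Data.Maybe using (Maybe; just; nothing)
open import Data.Product using (_×_; _,_; proj₁; proj₂)
import Data.Product as Product
open import Data.Sum using (_⊎_; inj₁; inj₂)
open import Function using (_∘_; id; case_of_; Equivalence)
open import Relation.Nullary using (¬_; yes; no; contradiction)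
open import Relation.Nullary.Decidable using (⌊_⌋)
open import Relation.Binary.PropositionalEquality using (_≢_; refl; sym; trans; cong; cong₂; subst; module ≡-Reasoning)
open import Relation.Binary using (tri<; tri≈; tri>)

T⇒≡true : ∀ {b} → T b → b ≡ true
T⇒≡true = Equivalence.to T-≡

≡true⇒T : ∀ {b} → b ≡ true → T b
≡true⇒T = Equivalence.from T-≡

¬T⇒≡false : ∀ {b} → ¬ T b → b ≡ false
¬T⇒≡false {true}  ¬t = contradiction _ ¬t
¬T⇒≡false {false} _  = refl

ΣV-suc : ∀ {n} (f : Fin (suc n) → ℕ) → ΣV f ≡ f fzero + ΣV (f ∘ fsuc)
ΣV-suc f = cong (λ l → f fzero + sum l) (trans (map-tabulate fsuc f) (sym (map-tabulate id (f ∘ fsuc))))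

ΣV-cong : ∀ {n} {f g : Fin n → ℕ} → (∀ v → f v ≡ g v) → ΣV f ≡ ΣV g
ΣV-cong {zero}          f≡g = refl
ΣV-cong {suc n} {f} {g} f≡g rewrite ΣV-suc f | ΣV-suc g = cong₂ _+_ (f≡g fzero) (ΣV-cong (f≡g ∘ fsuc))

ΣV-zero : ∀ {n} {f : Fin n → ℕ} → (∀ v → f v ≡ 0) → ΣV f ≡ 0
ΣV-zero {zero}      f≡0 = refl
ΣV-zero {suc n} {f} f≡0 rewrite ΣV-suc f | f≡0 fzero = ΣV-zero (f≡0 ∘ fsuc)

ΣV-mono-≤ : ∀ {n} {f g : Fin n → ℕ} → (∀ v → f v ≤ g v) → ΣV f ≤ ΣV g
ΣV-mono-≤ {zero}          f≤g = z≤n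
ΣV-mono-≤ {suc n} {f} {g} f≤g
  rewrite ΣV-suc f | ΣV-suc g = +-mono-≤ (f≤g fzero) (ΣV-mono-≤ (f≤g ∘ fsuc))

ΣV-mono-< : ∀ {n} {f g : Fin n → ℕ} → (∀ v → f v ≤ g v) → ∀ w → f w < g w → ΣV f < ΣV g
ΣV-mono-< {suc n} {f} {g} f≤g fzero    f<g rewrite ΣV-suc f | ΣV-suc g =
  +-mono-<-≤ f<g (ΣV-mono-≤ (f≤g ∘ fsuc))
ΣV-mono-< {suc n} {f} {g} f≤g (fsuc w) f<g rewrite ΣV-suc f | ΣV-suc g =
  +-mono-≤-< (f≤g fzero) (ΣV-mono-< (f≤g ∘ fsuc) w f<g)

ΣV<ΣV⇒∃< : ∀ {n} {f g : Fin n → ℕ} → ΣV f < ΣV g → ∃ λ v → f v < g v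
ΣV<ΣV⇒∃< {f = f} {g} ΣVf<ΣVg with any? (λ v → f v <? g v)
... | yes f<g = f<g
... | no ¬f<g = contradiction (ΣV-mono-≤ (λ v → ≮⇒≥ (λ f<g → ¬f<g (v , f<g)))) (<⇒≱ ΣVf<ΣVg)

⌊fsuc≟fsuc⌋ : ∀ {n} (w v : Fin n) → ⌊ fsuc w ≟ fsuc v ⌋ ≡ ⌊ w ≟ v ⌋
⌊fsuc≟fsuc⌋ w v with w ≟ v
... | yes _ = refl
... | no _  = refl

ΣV-pick : ∀ {n} (f : Fin n → ℕ) w → ΣV (λ v → if ⌊ w ≟ v ⌋ then f v else 0) ≡ f w
ΣV-pick {suc n} f fzero
  rewrite ΣV-suc (λ v → if ⌊ fzero ≟ v ⌋ then f v else 0)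
        | ΣV-zero {f = λ v → if ⌊ fzero ≟ fsuc v ⌋ then f (fsuc v) else 0} (λ _ → refl)
  = +-identityʳ (f fzero)
ΣV-pick {suc n} f (fsuc w)
  rewrite ΣV-suc (λ v → if ⌊ fsuc w ≟ v ⌋ then f v else 0)
  = trans (ΣV-cong (λ v → cong (if_then f (fsuc v) else 0) (⌊fsuc≟fsuc⌋ w v))) (ΣV-pick (f ∘ fsuc) w)

term≤ΣV : ∀ {n} (f : Fin n → ℕ) w → f w ≤ ΣV f
term≤ΣV f w = subst (_≤ ΣV f) (ΣV-pick f w) (ΣV-mono-≤ picked≤f)
  where
  picked≤f : ∀ v → (if ⌊ w ≟ v ⌋ then f v else 0) ≤ f v
  picked≤f v with ⌊ w ≟ v ⌋
  ... | true  = ≤-refl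
  ... | false = z≤n

if-then-0-<⇒ : ∀ b {a c} → (if b then a else 0) < (if b then c else 0) → T b × 1 ≤ c
if-then-0-<⇒ true a<c = _ , ≤-trans (s≤s z≤n) a<c

δ : ∀ {n} → Fin n → Fin n → ℕ
δ w v = if ⌊ w ≟ v ⌋ then 1 else 0

ΣV-δ : ∀ {n} (w : Fin n) → ΣV (δ w) ≡ 1
ΣV-δ = ΣV-pick (λ _ → 1)

ΣV-if-δ : ∀ {n} (b : Fin n → Bool) w → ΣV (λ v → if b v then δ w v else 0) ≡ (if b w then 1 else 0)
ΣV-if-δ b w = trans (ΣV-cong (λ v → if-swap-then (b v) ⌊ w ≟ v ⌋)) (ΣV-pick (λ v → if b v then 1 else 0) w)

sum< : ℕ → (ℕ → ℕ) → ℕ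
sum< zero    f = 0
sum< (suc M) f = f 0 + sum< M (f ∘ suc)

sum-map-applyUpTo : ∀ (g h : ℕ → ℕ) M → sum (map g (applyUpTo h M)) ≡ sum< M (g ∘ h)
sum-map-applyUpTo g h zero    = refl
sum-map-applyUpTo g h (suc M) = cong (g (h 0) +_) (sum-map-applyUpTo g (h ∘ suc) M)

Σ1to≡sum< : ∀ m f → Σ1to m f ≡ sum< m (f ∘ suc)
Σ1to≡sum< m f = sum-map-applyUpTo (f ∘ suc) id m

sum<-cong : ∀ M {f g : ℕ → ℕ} → (∀ k → f k ≡ g k) → sum< M f ≡ sum< M g
sum<-cong zero    f≡g = refl
sum<-cong (suc M) f≡g = cong₂ _+_ (f≡g 0) (sum<-cong M (f≡g ∘ suc))

sum<-suc : ∀ M f → sum< (suc M) f ≡ sum< M f + f M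
sum<-suc zero    f = +-identityʳ (f 0)
sum<-suc (suc M) f = trans (cong (f 0 +_) (sum<-suc M (f ∘ suc))) (sym (+-assoc (f 0) _ _))

sum<-zero : ∀ M {f : ℕ → ℕ} → (∀ k → f k ≡ 0) → sum< M f ≡ 0
sum<-zero zero    f≡0 = refl
sum<-zero (suc M) f≡0 rewrite f≡0 0 = sum<-zero M (f≡0 ∘ suc)

at : ∀ {A : Set} → List A → ℕ → Maybe A
at []       _       = nothing
at (x ∷ xs) zero    = just x
at (x ∷ xs) (suc k) = at xs k

at-lookup : ∀ {A : Set} (xs : List A) (i : Fin (length xs)) → at xs (toℕ i) ≡ just (lookup xs i)
at-lookup (x ∷ xs) fzero    = refl
at-lookup (x ∷ xs) (fsuc i) = at-lookup xs i

at≡just⇒lookup : ∀ {A : Set} (xs : List A) k {x} → at xs k ≡ just x →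
                 ∃ λ (i : Fin (length xs)) → toℕ i ≡ k × lookup xs i ≡ x
at≡just⇒lookup (y ∷ xs) zero    refl = fzero , refl , refl
at≡just⇒lookup (y ∷ xs) (suc k) eq   = Product.map fsuc (Product.map₁ (cong suc)) (at≡just⇒lookup xs k eq)

at-++ˡ : ∀ {A : Set} (xs ys : List A) {k} → k < length xs → at (xs ++ ys) k ≡ at xs k
at-++ˡ (x ∷ xs) ys {zero}  _         = refl
at-++ˡ (x ∷ xs) ys {suc k} (s≤s k<n) = at-++ˡ xs ys k<n

at-∷ʳ-length : ∀ {A : Set} (xs : List A) x → at (xs ∷ʳ x) (length xs) ≡ just x
at-∷ʳ-length []       x = refl
at-∷ʳ-length (y ∷ xs) x = at-∷ʳ-length xs x

at-∷ʳ-beyond : ∀ {A : Set} (xs : List A) x {k} → length xs < k → at (xs ∷ʳ x) k ≡ nothing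
at-∷ʳ-beyond []       x {suc k} _         = refl
at-∷ʳ-beyond (y ∷ xs) x {suc k} (s≤s n<k) = at-∷ʳ-beyond xs x n<k

take-++ˡ : ∀ {A : Set} (xs ys : List A) {k} → k ≤ length xs → take k (xs ++ ys) ≡ take k xs
take-++ˡ xs       ys {zero}  _         = refl
take-++ˡ (x ∷ xs) ys {suc k} (s≤s k≤n) = cong (x ∷_) (take-++ˡ xs ys k≤n)

take-length-++ : ∀ {A : Set} (xs ys : List A) → take (length xs) (xs ++ ys) ≡ xs
take-length-++ []       ys = refl
take-length-++ (x ∷ xs) ys = cong (x ∷_) (take-length-++ xs ys)

count : ∀ {A : Set} → Maybe A → ℕ
count nothing  = 0
count (just _) = 1

sum<-count-at : ∀ {A : Set} (xs : List A) M → length xs ≤ M → sum< M (count ∘ at xs) ≡ length xs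
sum<-count-at []       M       _         = sum<-zero M (λ _ → refl)
sum<-count-at (x ∷ xs) (suc M) (s≤s n≤M) = cong suc (sum<-count-at xs M n≤M)

δ? : ∀ {n} → Maybe (Fin n) → Fin n → ℕ
δ? nothing  _ = 0
δ? (just w) v = δ w v

δ?≤1 : ∀ {n} (mw : Maybe (Fin n)) v → δ? mw v ≤ 1
δ?≤1 nothing  v = z≤n
δ?≤1 (just w) v with ⌊ w ≟ v ⌋
... | true  = ≤-refl
... | false = z≤n

ΣV-δ? : ∀ {n} (mw : Maybe (Fin n)) → ΣV (δ? mw) ≡ count mw
ΣV-δ? {n} nothing = ΣV-zero {n} {δ? nothing} (λ _ → refl)
ΣV-δ?     (just w) = ΣV-δ w

sum<-δ?-at-∉ : ∀ {n} (xs : List (Fin n)) {v} → All (v ≢_) xs → ∀ M → sum< M (λ k → δ? (at xs k) v) ≡ 0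
sum<-δ?-at-∉ []       _            M       = sum<-zero M (λ _ → refl)
sum<-δ?-at-∉ (w ∷ xs) _            zero    = refl
sum<-δ?-at-∉ (w ∷ xs) {v} (v≢w ∷ v∉xs) (suc M) with w ≟ v
... | yes w≡v = contradiction (sym w≡v) v≢w
... | no _    = sum<-δ?-at-∉ xs v∉xs M

sum<-δ?-at-unique : ∀ {n} (xs : List (Fin n)) v → Unique xs → ∀ M → sum< M (λ k → δ? (at xs k) v) ≤ 1
sum<-δ?-at-unique []       v _               M       = ≤-trans (≤-reflexive (sum<-zero M (λ _ → refl))) z≤n
sum<-δ?-at-unique (w ∷ xs) v _               zero    = z≤n
sum<-δ?-at-unique (w ∷ xs) v (w∉xs ∷ unique) (suc M) with w ≟ v
... | yes refl = ≤-reflexive (cong suc (sum<-δ?-at-∉ xs w∉xs M))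
... | no _     = sum<-δ?-at-unique xs v unique M

module _ {n} (G : SimpleGraph n) (C : Fin n → Bool) where

  nb-off : ∀ {u v} → u ≢ v → nb G C v u ≡ adj G v u
  nb-off {u} {v} u≢v with u ≟ v | C v
  ... | yes u≡v | _     = contradiction u≡v u≢v
  ... | no _    | true  = refl
  ... | no _    | false = refl

  nb-sym : ∀ u v → nb G C u v ≡ nb G C v u
  nb-sym u v = case u ≟ v of λ where
    (yes u≡v) → cong₂ (nb G C) u≡v (sym u≡v)
    (no u≢v)  → let open ≡-Reasoning in begin
      nb G C u v  ≡⟨ nb-off (u≢v ∘ sym) ⟩
      adj G u v   ≡⟨ symm G u v ⟩
      adj G v u   ≡⟨ nb-off u≢v ⟨
      nb G C v u  ∎

  InN-sym : ∀ {u v} → InN G C u v → InN G C v u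
  InN-sym {u} {v} = subst T (nb-sym v u)

  term≤ΣN : ∀ {u v} (f : Fin n → ℕ) → InN G C v u → f v ≤ ΣN G C u f
  term≤ΣN {u} {v} f v∈N⟨u⟩ =
    subst (_≤ ΣN G C u f) (cong (if_then f v else 0) (T⇒≡true v∈N⟨u⟩)) (term≤ΣV (λ w → if nb G C u w then f w else 0) v)

  covers : List (Fin n) → Fin n → Bool
  covers []      u = false
  covers (w ∷ s) u = nb G C w u ∨ covers s u

  covers-++ : ∀ s t u → covers (s ++ t) u ≡ covers s u ∨ covers t u
  covers-++ []      t u = refl
  covers-++ (w ∷ s) t u = trans (cong (nb G C w u ∨_) (covers-++ s t u)) (sym (∨-assoc (nb G C w u) _ _))

  covers-++⁺ˡ : ∀ s t {u} → covers s u ≡ true → covers (s ++ t) u ≡ true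
  covers-++⁺ˡ s t {u} covered = trans (covers-++ s t u) (cong (_∨ covers t u) covered)

  ∈⇒covers : ∀ {s v u} → v ∈ s → InN G C u v → covers s u ≡ true
  ∈⇒covers {v ∷ s} {u = u} (here refl) u∈N⟨v⟩ = cong (_∨ covers s u) (T⇒≡true u∈N⟨v⟩)
  ∈⇒covers {w ∷ s} {u = u} (there v∈s) u∈N⟨v⟩ =
    trans (cong (nb G C w u ∨_) (∈⇒covers v∈s u∈N⟨v⟩)) (∨-zeroʳ (nb G C w u))

  uncovered⇒∉ : ∀ {s v u} → covers s u ≡ false → InN G C u v → v ∉ s
  uncovered⇒∉ uncovered u∈N⟨v⟩ v∈s with trans (sym (∈⇒covers v∈s u∈N⟨v⟩)) uncovered
  ... | ()

  covers-∷ʳ⁻ : ∀ s w {u} → covers s u ≡ false → nb G C w u ≡ false → covers (s ∷ʳ w) u ≡ false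
  covers-∷ʳ⁻ s w {u} uncovered u∉N⟨w⟩ rewrite covers-++ s [ w ] u | uncovered | u∉N⟨w⟩ = refl

  covers⇒∃ : ∀ s u → covers s u ≡ true → ∃ λ (j : Fin (length s)) → InN G C u (lookup s j)
  covers⇒∃ (w ∷ s) u covered with nb G C w u in eq
  ... | true  = fzero , ≡true⇒T eq
  ... | false = let j , u∈N⟨sⱼ⟩ = covers⇒∃ s u covered in fsuc j , u∈N⟨sⱼ⟩

  uncovered-take⇒¬InN : ∀ s k {j w} u → covers (take k s) u ≡ false → at s j ≡ just w → j < k → ¬ InN G C u w
  uncovered-take⇒¬InN (v ∷ s) (suc k) {zero}  u uncovered refl _         = subst T (∨-conicalˡ _ _ uncovered)
  uncovered-take⇒¬InN (v ∷ s) (suc k) {suc j} u uncovered eq   (s≤s j<k) =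
    uncovered-take⇒¬InN s k u (∨-conicalʳ _ _ uncovered) eq j<k

  ¬InN⇒uncovered-take : ∀ s k u → (∀ (j : Fin (length s)) → toℕ j < k → ¬ InN G C u (lookup s j)) →
                        covers (take k s) u ≡ false
  ¬InN⇒uncovered-take s       zero    u _ = refl
  ¬InN⇒uncovered-take []      (suc k) u _ = refl
  ¬InN⇒uncovered-take (w ∷ s) (suc k) u ¬InN
    rewrite ¬T⇒≡false (¬InN fzero (s≤s z≤n)) = ¬InN⇒uncovered-take s k u (λ j j<k → ¬InN (fsuc j) (s≤s j<k))

  covers-take-suc : ∀ s k u → covers (take k s) u ≡ true → covers (take (suc k) s) u ≡ true
  covers-take-suc (w ∷ s) (suc k) u covered with nb G C w u
  ... | true  = refl
  ... | false = covers-take-suc s k u covered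

  at⇒covers-take-suc : ∀ s k {w} u → at s k ≡ just w → InN G C u w → covers (take (suc k) s) u ≡ true
  at⇒covers-take-suc (v ∷ s) zero    u refl u∈N⟨v⟩ = cong (_∨ _) (T⇒≡true u∈N⟨v⟩)
  at⇒covers-take-suc (v ∷ s) (suc k) u eq   u∈N⟨w⟩ =
    trans (cong (nb G C v u ∨_) (at⇒covers-take-suc s k u eq u∈N⟨w⟩)) (∨-zeroʳ (nb G C v u))

  Footprints : List (Fin n) → Fin n → Set
  Footprints s v = ∃ λ u → InN G C u v × covers s u ≡ false

  LegalByPrefix : List (Fin n) → Set
  LegalByPrefix s = Unique s × (∀ k {v} → 1 ≤ k → at s k ≡ just v → Footprints (take k s) v)

  legalByPrefix⇒legal : ∀ {s} → LegalByPrefix s → Legal G C s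
  legalByPrefix⇒legal {s} (unique , footprints) = unique , λ i 1≤i →
    let u , u∈N⟨sᵢ⟩ , uncovered = footprints (toℕ i) 1≤i (at-lookup s i)
    in u , u∈N⟨sᵢ⟩ , λ j j<i → uncovered-take⇒¬InN s (toℕ i) u uncovered (at-lookup s j) j<i

  legal⇒legalByPrefix : ∀ {s} → Legal G C s → LegalByPrefix s
  legal⇒legalByPrefix {s} (unique , legal) = unique , λ k 1≤k eq →
    let i , i≡k , sᵢ≡v = at≡just⇒lookup s k eq
        u , u∈N⟨sᵢ⟩ , ¬InN = legal i (subst (1 ≤_) (sym i≡k) 1≤k)
    in u , subst (InN G C u) sᵢ≡v u∈N⟨sᵢ⟩ ,
       subst (λ k → covers (take k s) u ≡ false) i≡k (¬InN⇒uncovered-take s (toℕ i) u ¬InN)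

  Appendable : List (Fin n) → Fin n → Set
  Appendable s v = s ≡ [] ⊎ Footprints s v

  appendable⇒∉ : ∀ {s v} → Appendable s v → v ∉ s
  appendable⇒∉ (inj₁ refl)                    = λ ()
  appendable⇒∉ (inj₂ (_ , u∈N⟨v⟩ , uncovered)) = uncovered⇒∉ uncovered u∈N⟨v⟩

  appendable⇒footprints : ∀ {s v} → Appendable s v → 1 ≤ length s → Footprints s v
  appendable⇒footprints (inj₁ refl)         ()
  appendable⇒footprints (inj₂ v-footprints) _ = v-footprints

  ∷ʳ-legal : ∀ {s v} → LegalByPrefix s → Appendable s v → LegalByPrefix (s ∷ʳ v)
  ∷ʳ-legal {s} {v} (unique , footprints) appendable =
    ++⁺ unique ([] ∷ []) (λ { (v∈s , here refl) → appendable⇒∉ appendable v∈s }) , footprints′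
    where
    footprints′ : ∀ k {v′} → 1 ≤ k → at (s ∷ʳ v) k ≡ just v′ → Footprints (take k (s ∷ʳ v)) v′
    footprints′ k 1≤k eq with <-cmp k (length s)
    ... | tri< k<∣s∣ _ _ rewrite take-++ˡ s [ v ] (<⇒≤ k<∣s∣) =
      footprints k 1≤k (trans (sym (at-++ˡ s [ v ] k<∣s∣)) eq)
    ... | tri> _ _ ∣s∣<k = contradiction (trans (sym (at-∷ʳ-beyond s v ∣s∣<k)) eq) λ ()
    ... | tri≈ _ refl _ rewrite take-length-++ s [ v ] with trans (sym (at-∷ʳ-length s v)) eq
    ...   | refl = appendable⇒footprints appendable 1≤k

  module FromLegal {s : List (Fin n)} (legal : LegalByPrefix s) (m : ℕ) (∣s∣≤m : length s ≤ m) where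

    y : Fin n → ℕ → ℕ
    y v zero    = 0
    y v (suc k) = δ? (at s k) v

    x : Fin n → ℕ → ℕ
    x u i = if covers (take i s) u then 0 else 1

    x≤1 : ∀ u i → x u i ≤ 1
    x≤1 u i with covers (take i s) u
    ... | true  = z≤n
    ... | false = ≤-refl

    x-antitone : ∀ u k → x u (suc k) ≤ x u k
    x-antitone u k with covers (take k s) u in covered
    ... | true rewrite covers-take-suc s k u covered = z≤n
    ... | false = x≤1 u (suc k)

    x-antitone-on-N : ∀ v k u → (if nb G C v u then x u (suc k) else 0) ≤ (if nb G C v u then x u k else 0)
    x-antitone-on-N v k u with nb G C v u
    ... | true  = x-antitone u k
    ... | false = z≤n

    constraint-d : ∀ u k → x u (suc k) + ΣN G C u (δ? (at s k)) ≤ 1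
    constraint-d u k with at s k in sₖ≡w
    ... | nothing rewrite ΣV-zero {f = λ v → if nb G C u v then 0 else 0} (λ v → if-eta (nb G C u v)) | +-identityʳ (x u (suc k)) =
      x≤1 u (suc k)
    ... | just w rewrite ΣV-if-δ (nb G C u) w with nb G C u w in w∈N⟨u⟩
    ...   | false rewrite +-identityʳ (x u (suc k)) = x≤1 u (suc k)
    ...   | true rewrite at⇒covers-take-suc s k u sₖ≡w (≡true⇒T (trans (nb-sym w u) w∈N⟨u⟩)) = ≤-refl

    constraint-e : ∀ v k → 1 ≤ k → δ? (at s k) v + ΣN G C v (λ u → x u (suc k)) ≤ ΣN G C v (λ u → x u k)
    constraint-e v k 1≤k with at s k in sₖ≡w
    ... | nothing = ΣV-mono-≤ (x-antitone-on-N v k)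
    ... | just w with w ≟ v
    ...   | no _     = ΣV-mono-≤ (x-antitone-on-N v k)
    ...   | yes refl with proj₂ legal k 1≤k sₖ≡w
    ...     | u , u∈N⟨w⟩ , uncovered = ΣV-mono-< (x-antitone-on-N w k) u x-drops
      where
      x-drops : (if nb G C w u then x u (suc k) else 0) < (if nb G C w u then x u k else 0)
      x-drops rewrite T⇒≡true u∈N⟨w⟩ | at⇒covers-take-suc s k u sₖ≡w u∈N⟨w⟩ | uncovered =
        ≤-refl

    feasible : FeasibleF1 G C m x y
    feasible = (λ _ → refl)
             , (λ { v (suc k) _ _ → x≤1 v (suc k) , δ?≤1 (at s k) v })
             , (λ { (suc k) _ _ → subst (_≤ 1) (sym (ΣV-δ? (at s k))) (count≤1 (at s k)) })
             , (λ v → subst (_≤ 1) (sym (Σ1to≡sum< m (y v))) (sum<-δ?-at-unique s v (proj₁ legal) m))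
             , (λ { u (suc k) _ _ → x-antitone u k })
             , (λ { u (suc k) _ _ → constraint-d u k })
             , (λ { v (suc (suc k)) _ _ → constraint-e v (suc k) (s≤s z≤n) ; v (suc zero) (s≤s ()) _ })
      where
      count≤1 : ∀ (mw : Maybe (Fin n)) → count mw ≤ 1
      count≤1 nothing  = z≤n
      count≤1 (just _) = ≤-refl

    objective : ObjF1 m y ≡ length s
    objective = begin
      ObjF1 m y                          ≡⟨ Σ1to≡sum< m (λ i → ΣV (λ v → y v i)) ⟩
      sum< m (λ k → ΣV (δ? (at s k)))    ≡⟨ sum<-cong m (ΣV-δ? ∘ at s) ⟩
      sum< m (count ∘ at s)              ≡⟨ sum<-count-at s m ∣s∣≤m ⟩
      length s                           ∎
      where open ≡-Reasoning

  adj⇒InN : ∀ {u w} → adj G w u ≡ true → InN G C u w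
  adj⇒InN {u} {w} wu-adjacent with C w
  ... | true  = ≡true⇒T (trans (cong (⌊ u ≟ w ⌋ ∨_) wu-adjacent) (∨-zeroʳ _))
  ... | false = ≡true⇒T wu-adjacent

  InN-self : ∀ {u} → C u ≡ true → InN G C u u
  InN-self {u} u∈C rewrite u∈C with u ≟ u
  ... | yes _   = _
  ... | no u≢u = contradiction refl u≢u

  noIsolated⇒dominated : (∀ v → C v ≡ false → ∃ λ u → adj G v u ≡ true) → ∀ u → ∃ (InN G C u)
  noIsolated⇒dominated noIsolated u with C u in u-in-C
  ... | true  = u , InN-self u-in-C
  ... | false = let w , uw-adjacent = noIsolated u u-in-C in w , adj⇒InN (trans (symm G w u) uw-adjacent)

  module _ (dominated : ∀ u → ∃ (InN G C u)) where

    extend : ∀ (l : List (Fin n)) s → LegalByPrefix s →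
             ∃ λ s′ → LegalByPrefix s′ × length s ≤ length s′ ×
                      (∀ u → covers s u ≡ true → covers s′ u ≡ true) × All (λ u → covers s′ u ≡ true) l
    extend []      s legal = s , legal , ≤-refl , (λ _ → id) , []
    extend (u ∷ l) s legal with covers s u in u-covered
    ... | true  =
      let s′ , legal′ , ∣s∣≤∣s′∣ , preserved , covered = extend l s legal
      in  s′ , legal′ , ∣s∣≤∣s′∣ , preserved , preserved u u-covered ∷ covered
    ... | false =
      let w , u∈N⟨w⟩ = dominated u
          s′ , legal′ , ∣s∣≤∣s′∣ , preserved , covered = extend l (s ∷ʳ w) (∷ʳ-legal legal (inj₂ (u , u∈N⟨w⟩ , u-covered)))
      in  s′ , legal′ , ≤-trans (length-++-≤ˡ s) ∣s∣≤∣s′∣ ,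
          (λ v → preserved v ∘ covers-++⁺ˡ s [ w ]) ,
          preserved u (∈⇒covers (∈-++⁺ʳ s (here refl)) u∈N⟨w⟩) ∷ covered

    extendToDominating : ∀ {s} → LegalByPrefix s → ∃ λ s′ → Legal G C s′ × Dominating G C s′ × length s ≤ length s′
    extendToDominating {s} legal =
      let s′ , legal′ , ∣s∣≤∣s′∣ , _ , covered = extend (allFin n) s legal
      in  s′ , legalByPrefix⇒legal legal′ , (λ u → covers⇒∃ s′ u (All.lookup covered (∈-allFin u))) , ∣s∣≤∣s′∣

  module FromFeasible {m : ℕ} {x y : Fin n → ℕ → ℕ} (feasible : FeasibleF1 G C m x y) where

    constraint-a : ∀ i → 1 ≤ i → i ≤ m → ΣV (λ v → y v i) ≤ 1
    constraint-a = proj₁ (proj₂ (proj₂ feasible))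

    constraint-c : ∀ u i → 2 ≤ i → i ≤ m → x u i ≤ x u (i ∸ 1)
    constraint-c = proj₁ (proj₂ (proj₂ (proj₂ (proj₂ feasible))))

    constraint-d : ∀ u i → 1 ≤ i → i ≤ m → x u i + ΣN G C u (λ v → y v i) ≤ 1
    constraint-d = proj₁ (proj₂ (proj₂ (proj₂ (proj₂ (proj₂ feasible)))))

    constraint-e : ∀ v i → 2 ≤ i → i ≤ m → y v i + ΣN G C v (λ u → x u i) ≤ ΣN G C v (λ u → x u (i ∸ 1))
    constraint-e = proj₂ (proj₂ (proj₂ (proj₂ (proj₂ (proj₂ feasible)))))

    objective< : ℕ → ℕ
    objective< k = sum< k (λ i → ΣV (λ v → y v (suc i)))

    ReadOff : ℕ → Set
    ReadOff k = ∃ λ s → LegalByPrefix s × length s ≡ objective< k × (∀ u → 1 ≤ x u k → covers s u ≡ false)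

    stillUncovered : ∀ k → suc k ≤ m → (r : ReadOff k) → ∀ u → 1 ≤ x u (suc k) → covers (proj₁ r) u ≡ false
    stillUncovered zero    _     ([] , _)                  _ _   = refl
    stillUncovered zero    _     (_ ∷ _ , _ , () , _)
    stillUncovered (suc k) k+2≤m (_ , _ , _ , uncovered) u 1≤x =
      uncovered u (≤-trans 1≤x (constraint-c u (suc (suc k)) (s≤s (s≤s z≤n)) k+2≤m))

    appendable : ∀ k → suc k ≤ m → (r : ReadOff k) → ∀ {v} → 1 ≤ y v (suc k) → Appendable (proj₁ r) v
    appendable zero    _     ([] , _)                _   = inj₁ refl
    appendable zero    _     (_ ∷ _ , _ , () , _)
    appendable (suc k) k+2≤m (_ , _ , _ , uncovered) {v} 1≤y
      with ΣV<ΣV⇒∃< (≤-trans (+-monoˡ-≤ _ 1≤y) (constraint-e v (suc (suc k)) (s≤s (s≤s z≤n)) k+2≤m))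
    ... | u , x-drops =
      let u∈N⟨v⟩ , 1≤x = if-then-0-<⇒ (nb G C v u) x-drops in inj₂ (u , u∈N⟨v⟩ , uncovered u 1≤x)

    chosen-avoids-undominated : ∀ k → suc k ≤ m → ∀ {u v} → 1 ≤ y v (suc k) → 1 ≤ x u (suc k) → nb G C v u ≡ false
    chosen-avoids-undominated k k+1≤m {u} {v} 1≤y 1≤x = ¬T⇒≡false λ u∈N⟨v⟩ →
      <⇒≱ (+-mono-≤ 1≤x (≤-trans 1≤y (term≤ΣN (λ w → y w (suc k)) (InN-sym u∈N⟨v⟩))))
          (constraint-d u (suc k) (s≤s z≤n) k+1≤m)

    readOff : ∀ k → k ≤ m → ReadOff k
    readOff zero    _     = [] , ([] , λ _ _ ()) , refl , λ _ _ → refl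
    readOff (suc k) k+1≤m with readOff k (<⇒≤ k+1≤m) | any? (λ v → 1 ≤? y v (suc k))
    ... | r@(s , legal , ∣s∣≡obj , _) | no ¬chosen =
      s , legal , trans ∣s∣≡obj objective-unchanged , stillUncovered k k+1≤m r
      where
      objective-unchanged : objective< k ≡ objective< (suc k)
      objective-unchanged = begin
        objective< k                              ≡⟨ +-identityʳ _ ⟨
        objective< k + 0                          ≡⟨ cong (objective< k +_) (ΣV-zero (λ v → n≤0⇒n≡0 (≮⇒≥ (λ 1≤y → ¬chosen (v , 1≤y))))) ⟨
        objective< k + ΣV (λ v → y v (suc k))     ≡⟨ sum<-suc k _ ⟨
        objective< (suc k)                        ∎
        where open ≡-Reasoning
    ... | r@(s , legal , ∣s∣≡obj , uncovered) | yes (v , 1≤y) =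
      s ∷ʳ v , ∷ʳ-legal legal (appendable k k+1≤m r 1≤y) , objective-increases , uncovered′
      where
      one-chosen : ΣV (λ w → y w (suc k)) ≡ 1
      one-chosen = ≤-antisym (constraint-a (suc k) (s≤s z≤n) k+1≤m) (≤-trans 1≤y (term≤ΣV (λ w → y w (suc k)) v))

      objective-increases : length (s ∷ʳ v) ≡ objective< (suc k)
      objective-increases = begin
        length (s ∷ʳ v)                           ≡⟨ length-++ s ⟩
        length s + 1                              ≡⟨ cong₂ _+_ ∣s∣≡obj (sym one-chosen) ⟩
        objective< k + ΣV (λ w → y w (suc k))     ≡⟨ sum<-suc k _ ⟨
        objective< (suc k)                        ∎
        where open ≡-Reasoning

      uncovered′ : ∀ u → 1 ≤ x u (suc k) → covers (s ∷ʳ v) u ≡ false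
      uncovered′ u 1≤x = covers-∷ʳ⁻ s v (stillUncovered k k+1≤m r u 1≤x) (chosen-avoids-undominated k k+1≤m 1≤y 1≤x)

    feasible⇒legal : ∃ λ s → LegalByPrefix s × length s ≡ ObjF1 m y
    feasible⇒legal =
      let s , legal , ∣s∣≡obj , _ = readOff m ≤-refl
      in  s , legal , trans ∣s∣≡obj (sym (Σ1to≡sum< m (λ i → ΣV (λ v → y v i))))

theorem1 : ∀ {n} (G : SimpleGraph n) (C : Fin n → Bool) →
    (∀ v → C v ≡ false → ∃ λ u → adj G v u ≡ true) →
    (m : ℕ) → 1 ≤ m →
    (g : ℕ) → IsGrundyDom G C g → g ≤ m →
    IsOptF1 G C m g
theorem1 G C noIsolated m _ _ ((s , legal , _ , refl) , maximal) ∣s∣≤m =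
  (x , y , feasible , objective) , optimum≤γ
  where
  open FromLegal G C (legal⇒legalByPrefix G C legal) m ∣s∣≤m

  optimum≤γ : ∀ x y → FeasibleF1 G C m x y → ObjF1 m y ≤ length s
  optimum≤γ x y feasible′ =
    let s₀ , legal₀ , ∣s₀∣≡obj = FromFeasible.feasible⇒legal G C feasible′
        s′ , legal′ , dominating′ , ∣s₀∣≤∣s′∣ = extendToDominating G C (noIsolated⇒dominated G C noIsolated) legal₀
    in  subst (_≤ length s) ∣s₀∣≡obj (≤-trans ∣s₀∣≤∣s′∣ (maximal s′ legal′ dominating′))
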